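{- Let $U$ be a non-principal ultrafilter on $\omega$. The following are equivalent: (1) $U$ is almost-rapid; (2) for every sequence $\langle P_n:n<\omega\rangle$ of finite subsets of $\omega$ there is $X\in U$ such that $|X\cap P_n|\le exp(f_X)(n-1)$ for every $n<\omega$, where $exp(f_X)(-1)=0$.
   Context: For infinite $X\subseteq\omega$, $f_X$ is the increasing enumeration of $X$. For $f:\omega\to\omega$, $exp(f)(0)=f(0)$ and $exp(f)(n+1)=f(exp(f)(n))$. $U$ is almost-rapid if for every $f\in\omega^\omega$ there is $X\in U$ with $exp(f_X)\ge^* f$, i.e. $exp(f_X)(n)\ge f(n)$ for all but finitely many $n$. -}

module Defs where

open import Data.Nat using (ℕ; zero; suc; _+_; _∸_; _≤_; _<_)
open import Data.Bool using (Bool; true; false; if_then_else_; _∧_; not)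
open import Data.Product using (Σ; _×_; proj₁)
open import Data.Sum using (_⊎_)
open import Data.Empty using (⊥)
open import Relation.Nullary using (¬_)
open import Relation.Binary.PropositionalEquality using (_≡_)

Subset : Set
Subset = ℕ → Bool

_⊆_ : Subset → Subset → Set
A ⊆ B = ∀ n → A n ≡ true → B n ≡ true

_∩_ : Subset → Subset → Subset
(A ∩ B) n = A n ∧ B n

complement : Subset → Subset
complement A n = not (A n)

full : Subset
full _ = true

empty : Subset
empty _ = false

singleton : ℕ → Subset
singleton m n = if Data.Nat._≡ᵇ_ m n then true else false

record IsUltrafilter (U : Subset → Set) : Set₁ where
  field
    full∈   : U full
    empty∉  : ¬ U empty
    upward  : ∀ {A B} → A ⊆ B → U A → U B
    inter   : ∀ {A B} → U A → U B → U (A ∩ B)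
    ultra   : ∀ A → U A ⊎ U (complement A)

NonPrincipal : (Subset → Set) → Set
NonPrincipal U = ∀ n → ¬ U (singleton n)

Infinite : Subset → Set
Infinite X = ∀ n → Σ ℕ λ m → n ≤ m × X m ≡ true

search : Subset → ℕ → ℕ → ℕ
search X n zero = n
search X n (suc k) = if X n then n else search X (suc n) k

-- least element of X that is ≥ n
next : (X : Subset) → Infinite X → ℕ → ℕ
next X inf n = search X n (suc (proj₁ (inf n) ∸ n))

-- f_X : increasing enumeration of the infinite set X
enum : (X : Subset) → Infinite X → ℕ → ℕ
enum X inf zero = next X inf 0
enum X inf (suc k) = next X inf (suc (enum X inf k))

exp : (ℕ → ℕ) → ℕ → ℕ
exp f zero = f zero
exp f (suc n) = f (exp f n)

-- exp(f)(n-1) with the convention exp(f)(-1) = 0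
expPred : (ℕ → ℕ) → ℕ → ℕ
expPred f zero = 0
expPred f (suc n) = exp f n

_≥*_ : (ℕ → ℕ) → (ℕ → ℕ) → Set
g ≥* f = Σ ℕ λ N → ∀ n → N ≤ n → f n ≤ g n

AlmostRapid : (Subset → Set) → Set
AlmostRapid U = (f : ℕ → ℕ) →
  Σ Subset λ X → Σ (Infinite X) λ inf → U X × (exp (enum X inf) ≥* f)

count : Subset → ℕ → ℕ
count A zero = 0
count A (suc N) = (if A N then 1 else 0) + count A N

-- A sequence ⟨P_n⟩ of finite subsets of ω: P n is the n-th set, and
-- bnd n is a strict upper bound for its elements (so P n is finite).
-- |X ∩ P_n| is then count (X ∩ P n) (bnd n).
Condition2 : (Subset → Set) → Set
Condition2 U = (P : ℕ → Subset) (bnd : ℕ → ℕ) →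
  (∀ n m → P n m ≡ true → m < bnd n) →
  Σ Subset λ X → Σ (Infinite X) λ inf → U X ×
    (∀ n → count (X ∩ P n) (bnd n) ≤ expPred (enum X inf) n)

-- Everything is read off the enumeration f_X through the counting principle
-- |X ∩ [0, B)| ≤ c ⇒ B ≤ f_X(c).
-- (2) ⇒ (1): take P_n = [0, f(n)); then |X ∩ P_n| ≤ exp(f_X)(n-1) gives
-- f(n) ≤ f_X(exp(f_X)(n-1)) = exp(f_X)(n) for every n.
-- (1) ⇒ (2): cutting X down to a tail [M, ∞) keeps it in the non-principal U and only raises f_X,
-- so for M above the finitely many exceptional values f(n), and above max P_0, exp(f_X) ≥ f holds
-- everywhere and X ∩ P_0 = ∅. With f(n) = max P_{n+1} this gives |X ∩ P_{n+1}| ≤ exp(f_X)(n).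
module Submission where

open import Defs
open import Function.Base using (case_of_)
open import Function.Bundles using (_⇔_; mk⇔; module Equivalence)
open import Data.Nat using (ℕ; zero; suc; _+_; _∸_; _⊔_; _≤_; _<_; _≤′_; ≤′-refl; ≤′-step; z≤n; s≤s; _≤ᵇ_; _<ᵇ_; _≡ᵇ_)
open import Data.Nat.Properties
open import Data.Bool using (true; false; _∧_; not; if_then_else_)
open import Data.Bool.Properties using (T-≡; ∧-identityʳ)
open import Data.Product using (Σ; _×_; _,_)
open import Data.Sum using (inj₁; inj₂)
open import Data.Empty using (⊥-elim)
open import Relation.Nullary using (yes; no)
open import Relation.Binary.PropositionalEquality

∩-⊆ˡ : ∀ A B → (A ∩ B) ⊆ A
∩-⊆ˡ A B n A∧B with A n
... | true = refl

∩-⊆ʳ : ∀ A B → (A ∩ B) ⊆ B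
∩-⊆ʳ A B n A∧B with A n
... | true = A∧B

∈-∩ : ∀ {A B n} → A n ≡ true → B n ≡ true → (A ∩ B) n ≡ true
∈-∩ An Bn rewrite An = Bn

false-true⇒≢ : ∀ {A : Subset} {m n} → A m ≡ false → A n ≡ true → m ≢ n
false-true⇒≢ Am An refl = case trans (sym Am) An of λ ()

monotone-by-step : (f : ℕ → ℕ) → (∀ n → f n ≤ f (suc n)) → ∀ {m n} → m ≤ n → f m ≤ f n
monotone-by-step f step m≤n = go (≤⇒≤′ m≤n)
  where
  go : ∀ {m n} → m ≤′ n → f m ≤ f n
  go ≤′-refl      = ≤-refl
  go (≤′-step le) = ≤-trans (go le) (step _)

search-≥ : ∀ (X : Subset) n k → n ≤ search X n k
search-≥ X n zero = ≤-refl
search-≥ X n (suc k) with X n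
... | true  = ≤-refl
... | false = ≤-trans (n≤1+n n) (search-≥ X (suc n) k)

search-least : ∀ (X : Subset) n k {j} → n ≤ j → X j ≡ true → search X n k ≤ j
search-least X n zero    n≤j Xj = n≤j
search-least X n (suc k) n≤j Xj with X n in Xn
... | true  = n≤j
... | false = search-least X (suc n) k (≤∧≢⇒< n≤j (false-true⇒≢ Xn Xj)) Xj

search-∈ : ∀ (X : Subset) n k {m} → n ≤ m → m < n + k → X m ≡ true → X (search X n k) ≡ true
search-∈ X n zero {m} n≤m m<n+0 Xm = ⊥-elim (≤⇒≯ n≤m (subst (m <_) (+-identityʳ n) m<n+0))
search-∈ X n (suc k) {m} n≤m m<n+k Xm with X n in Xn
... | true  = Xn
... | false =
  search-∈ X (suc n) k (≤∧≢⇒< n≤m (false-true⇒≢ Xn Xm)) (subst (m <_) (+-suc n k) m<n+k) Xm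

next-∈ : ∀ (X : Subset) (inf : Infinite X) n → X (next X inf n) ≡ true
next-∈ X inf n with inf n
... | m , n≤m , Xm = search-∈ X n (suc (m ∸ n)) n≤m m<n+[1+m∸n] Xm
  where
  m<n+[1+m∸n] : m < n + suc (m ∸ n)
  m<n+[1+m∸n] = ≤-reflexive (sym (trans (+-suc n (m ∸ n)) (cong suc (m+[n∸m]≡n n≤m))))

next-≥ : ∀ (X : Subset) (inf : Infinite X) n → n ≤ next X inf n
next-≥ X inf n with inf n
... | m , _ = search-≥ X n (suc (m ∸ n))

next-least : ∀ (X : Subset) (inf : Infinite X) n {j} → n ≤ j → X j ≡ true → next X inf n ≤ j
next-least X inf n with inf n
... | m , _ = search-least X n (suc (m ∸ n))

enum-∈ : ∀ (X : Subset) (inf : Infinite X) k → X (enum X inf k) ≡ true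
enum-∈ X inf zero    = next-∈ X inf 0
enum-∈ X inf (suc k) = next-∈ X inf _

enum-< : ∀ (X : Subset) (inf : Infinite X) k → enum X inf k < enum X inf (suc k)
enum-< X inf k = next-≥ X inf _

enum-mono : ∀ (X : Subset) (inf : Infinite X) {k l} → k ≤ l → enum X inf k ≤ enum X inf l
enum-mono X inf = monotone-by-step (enum X inf) (λ k → <⇒≤ (enum-< X inf k))

enum-antitone-⊆ : ∀ {X Y} infX infY → Y ⊆ X → ∀ k → enum X infX k ≤ enum Y infY k
enum-antitone-⊆ {X} {Y} infX infY Y⊆X zero =
  next-least X infX 0 z≤n (Y⊆X _ (enum-∈ Y infY 0))
enum-antitone-⊆ {X} {Y} infX infY Y⊆X (suc k) =
  next-least X infX _ (≤-trans (s≤s (enum-antitone-⊆ infX infY Y⊆X k)) (enum-< Y infY k))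
    (Y⊆X _ (enum-∈ Y infY (suc k)))

exp≡∘expPred : ∀ (g : ℕ → ℕ) n → exp g n ≡ g (expPred g n)
exp≡∘expPred g zero    = refl
exp≡∘expPred g (suc n) = refl

exp-enum-∈ : ∀ (X : Subset) (inf : Infinite X) n → X (exp (enum X inf) n) ≡ true
exp-enum-∈ X inf zero    = enum-∈ X inf 0
exp-enum-∈ X inf (suc n) = enum-∈ X inf (exp (enum X inf) n)

exp-mono : ∀ {g h} → (∀ {a b} → a ≤ b → g a ≤ g b) → (∀ j → g j ≤ h j) → ∀ n → exp g n ≤ exp h n
exp-mono g-mono g≤h zero    = g≤h 0
exp-mono g-mono g≤h (suc n) = ≤-trans (g-mono (exp-mono g-mono g≤h n)) (g≤h _)

count-≤ : ∀ (A : Subset) N → count A N ≤ N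
count-≤ A zero = z≤n
count-≤ A (suc N) with A N
... | true  = s≤s (count-≤ A N)
... | false = m≤n⇒m≤1+n (count-≤ A N)

count-mono : ∀ (A : Subset) {N M} → N ≤ M → count A N ≤ count A M
count-mono A = monotone-by-step (count A) (λ N → m≤n+m (count A N) _)

count-∈ : ∀ (A : Subset) N → A N ≡ true → count A (suc N) ≡ suc (count A N)
count-∈ A N AN rewrite AN = refl

count-cong : ∀ (A B : Subset) N → (∀ m → m < N → A m ≡ B m) → count A N ≡ count B N
count-cong A B zero    A≗B = refl
count-cong A B (suc N) A≗B =
  cong₂ _+_ (cong (λ b → if b then 1 else 0) (A≗B N ≤-refl))
            (count-cong A B N (λ m m<N → A≗B m (m≤n⇒m≤1+n m<N)))

count-none : ∀ (A : Subset) N → (∀ m → m < N → A m ≢ true) → count A N ≡ 0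
count-none A zero    A∌ = refl
count-none A (suc N) A∌ with A N in AN
... | true  = ⊥-elim (A∌ N ≤-refl AN)
... | false = count-none A N (λ m m<N → A∌ m (m≤n⇒m≤1+n m<N))

count-enum : ∀ (X : Subset) (inf : Infinite X) c → suc c ≤ count X (suc (enum X inf c))
count-enum X inf zero = ≤-trans (s≤s z≤n) (≤-reflexive (sym (count-∈ X _ (enum-∈ X inf 0))))
count-enum X inf (suc c) = begin
  suc (suc c)                               ≤⟨ s≤s (count-enum X inf c) ⟩
  suc (count X (suc (enum X inf c)))        ≤⟨ s≤s (count-mono X (enum-< X inf c)) ⟩
  suc (count X (enum X inf (suc c)))        ≡⟨ count-∈ X _ (enum-∈ X inf (suc c)) ⟨
  count X (suc (enum X inf (suc c)))        ∎
  where open ≤-Reasoning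

count≤⇒≤enum : ∀ (X : Subset) (inf : Infinite X) {B c} → count X B ≤ c → B ≤ enum X inf c
count≤⇒≤enum X inf {B} {c} countB≤c = ≮⇒≥ λ enum<B →
  ≤⇒≯ countB≤c (≤-trans (count-enum X inf c) (count-mono X enum<B))

tail : ℕ → Subset
tail M m = M ≤ᵇ m

tail-≤ : ∀ {M m} → tail M m ≡ true → M ≤ m
tail-≤ {M} {m} e = ≤ᵇ⇒≤ M m (Equivalence.from T-≡ e)

≤-tail : ∀ {M m} → M ≤ m → tail M m ≡ true
≤-tail M≤m = Equivalence.to T-≡ (≤⇒≤ᵇ M≤m)

tail-antitone : ∀ {M M′} → M ≤ M′ → tail M′ ⊆ tail M
tail-antitone M≤M′ m e = ≤-tail (≤-trans M≤M′ (tail-≤ e))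

∩tail-infinite : ∀ {X} → Infinite X → ∀ M → Infinite (X ∩ tail M)
∩tail-infinite {X} inf M n with inf (n + M)
... | m , n+M≤m , Xm =
  m , ≤-trans (m≤m+n n M) n+M≤m , ∈-∩ {X} {tail M} Xm (≤-tail (≤-trans (m≤n+m M n) n+M≤m))

below : ℕ → Subset
below B m = m <ᵇ B

below-< : ∀ {B m} → below B m ≡ true → m < B
below-< {B} {m} e = <ᵇ⇒< m B (Equivalence.from T-≡ e)

<-below : ∀ {B m} → m < B → below B m ≡ true
<-below m<B = Equivalence.to T-≡ (<⇒<ᵇ m<B)

singleton-self : ∀ M → singleton M M ≡ true
singleton-self M with M ≡ᵇ M | ≡⇒≡ᵇ M M refl
... | true | _ = refl

tail∈ : ∀ {U} → IsUltrafilter U → NonPrincipal U → ∀ M → U (tail M)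
tail∈ uf np zero    = IsUltrafilter.upward uf (λ _ _ → refl) (IsUltrafilter.full∈ uf)
tail∈ uf np (suc M) with IsUltrafilter.ultra uf (singleton M)
... | inj₁ U∋singleton = ⊥-elim (np M U∋singleton)
... | inj₂ U∋cosingleton =
  IsUltrafilter.upward uf ⊆tail[1+M] (IsUltrafilter.inter uf (tail∈ uf np M) U∋cosingleton)
  where
  ⊆tail[1+M] : (tail M ∩ complement (singleton M)) ⊆ tail (suc M)
  ⊆tail[1+M] m e = ≤-tail (≤∧≢⇒< (tail-≤ (∩-⊆ˡ (tail M) (complement (singleton M)) m e)) M≢m)
    where
    M≢m : M ≢ m
    M≢m refl =
      case trans (sym (cong not (singleton-self M))) (∩-⊆ʳ (tail M) (complement (singleton M)) m e) of λ ()

maxUpTo : (ℕ → ℕ) → ℕ → ℕ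
maxUpTo b zero    = b zero
maxUpTo b (suc N) = maxUpTo b N ⊔ b (suc N)

≤-maxUpTo : ∀ (b : ℕ → ℕ) {k N} → k ≤ N → b k ≤ maxUpTo b N
≤-maxUpTo b k≤N = go (≤⇒≤′ k≤N)
  where
  top : ∀ N → b N ≤ maxUpTo b N
  top zero    = ≤-refl
  top (suc N) = m≤n⊔m _ _
  go : ∀ {k N} → k ≤′ N → b k ≤ maxUpTo b N
  go ≤′-refl      = top _
  go (≤′-step le) = ≤-trans (go le) (m≤m⊔n _ _)

RapidAbove : (Subset → Set) → Set
RapidAbove U = (f : ℕ → ℕ) (M : ℕ) →
  Σ Subset λ X → Σ (Infinite X) λ inf → U X × X ⊆ tail M × (∀ n → f n ≤ exp (enum X inf) n)

almostRapid⇒rapidAbove : ∀ {U} → IsUltrafilter U → NonPrincipal U → AlmostRapid U → RapidAbove U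
almostRapid⇒rapidAbove {U} uf np ar f M with ar f
... | X , inf , U∋X , N , f≤expₙ = X′ , inf′ , U∋X′ , X′⊆tailM , f≤exp′
  where
  M′ = M ⊔ maxUpTo f N
  X′ = X ∩ tail M′
  inf′ = ∩tail-infinite inf M′
  U∋X′ : U X′
  U∋X′ = IsUltrafilter.inter uf U∋X (tail∈ uf np M′)
  X′⊆tailM : X′ ⊆ tail M
  X′⊆tailM m e = tail-antitone {M} {M′} (m≤m⊔n M _) m (∩-⊆ʳ X (tail M′) m e)
  f≤exp′ : ∀ n → f n ≤ exp (enum X′ inf′) n
  f≤exp′ n with N ≤? n
  ... | yes N≤n = ≤-trans (f≤expₙ n N≤n)
                    (exp-mono (enum-mono X inf) (enum-antitone-⊆ inf inf′ (∩-⊆ˡ X (tail M′))) n)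
  ... | no  N≰n = ≤-trans (≤-maxUpTo f (<⇒≤ (≰⇒> N≰n)))
                    (≤-trans (m≤n⊔m M _) (tail-≤ {M′} (∩-⊆ʳ X (tail M′) _ (exp-enum-∈ X′ inf′ n))))

rapidAbove⇒condition2 : ∀ {U} → RapidAbove U → Condition2 U
rapidAbove⇒condition2 ra P bnd _ with ra (λ n → bnd (suc n)) (bnd 0)
... | X , inf , U∋X , X⊆tail , bnd≤exp = X , inf , U∋X , count≤expPred
  where
  count≤expPred : ∀ n → count (X ∩ P n) (bnd n) ≤ expPred (enum X inf) n
  count≤expPred zero = ≤-reflexive (count-none (X ∩ P 0) (bnd 0) X∩P₀-empty)
    where
    X∩P₀-empty : ∀ m → m < bnd 0 → (X ∩ P 0) m ≢ true
    X∩P₀-empty m m<bnd₀ e = ≤⇒≯ (tail-≤ (X⊆tail m (∩-⊆ˡ X (P 0) m e))) m<bnd₀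
  count≤expPred (suc n) = ≤-trans (count-≤ (X ∩ P (suc n)) (bnd (suc n))) (bnd≤exp n)

condition2⇒almostRapid : ∀ {U} → Condition2 U → AlmostRapid U
condition2⇒almostRapid c2 f with c2 (λ n → below (f n)) f (λ n m → below-<)
... | X , inf , U∋X , count≤expPred = X , inf , U∋X , 0 , λ n _ → f≤exp n
  where
  f≤exp : ∀ n → f n ≤ exp (enum X inf) n
  f≤exp n = subst (f n ≤_) (sym (exp≡∘expPred (enum X inf) n))
    (count≤⇒≤enum X inf (subst (_≤ expPred (enum X inf) n) count-below (count≤expPred n)))
    where
    count-below : count (X ∩ below (f n)) (f n) ≡ count X (f n)
    count-below = count-cong (X ∩ below (f n)) X (f n)
      λ m m<fn → trans (cong (X m ∧_) (<-below m<fn)) (∧-identityʳ (X m))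

proposition5p14 : (U : Subset → Set) → IsUltrafilter U → NonPrincipal U →
    AlmostRapid U ⇔ Condition2 U
proposition5p14 U uf np =
  mk⇔ (λ ar → rapidAbove⇒condition2 (almostRapid⇒rapidAbove uf np ar)) condition2⇒almostRapid
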